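{- Let $n\ge 2$, let $\Omega$ be a nonempty set, and let $d:\Omega^2\to\mathbb{R}$ be a pseudometric. Define the Fermat distance function $d_F:\Omega^n\to\mathbb{R}$ induced by $d$ by $$d_F(A_1,\dots,A_n)=\min_{B\in\Omega}\sum_{i=1}^n d(A_i,B).$$ Then $d_F$ is a pseudo $n$-metric.
   Context: A map $d:\Omega^2\to\mathbb{R}$ is a pseudometric if for all $A,B,C\in\Omega$: $d(A,B)\ge 0$; $d(A,A)=0$; $d(A,B)=d(B,A)$; $d(A,C)\le d(A,B)+d(B,C)$. For $A_1,\dots,A_{n+1}\in\Omega$ write $A_{1:n}=(A_1,\dots,A_n)$, and $A^i_{1:n,n+1}$ for the sequence obtained from $A_{1:n}$ by replacing its $i$-th entry $A_i$ by $A_{n+1}$. A map $D:\Omega^n\to\mathbb{R}$ is a pseudo $n$-metric if for all $A_1,\dots,A_{n+1}\in\Omega$: (a) $D(A_{1:n})\ge 0$; (b) $D(A_{\sigma(1)},\dots,A_{\sigma(n)})=D(A_{1:n})$ for every permutation $\sigma$ of $\{1,\dots,n\}$; (c) (generalized triangle inequality) $D(A_{1:n})\le\sum_{i=1}^n D(A^i_{1:n,n+1})$; (d) (self-identity) $D(A,\dots,A)=0$ for every $A\in\Omega$. The minimum in the definition of $d_F$ is assumed to be attained, as in the paper's definition. -}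

module Defs where

open import Level using (0ℓ)
open import Data.Nat using (ℕ; zero; suc; _≤_)
open import Data.Fin using (Fin; zero; suc)
open import Data.Fin.Permutation using (Permutation′; _⟨$⟩ʳ_)
open import Data.Product using (Σ; _×_)
open import Data.Vec.Functional using (Vector; updateAt)
open import Function using (_∘_; const)
open import Relation.Binary.PropositionalEquality using (_≡_; _≢_)
open import Relation.Binary.Structures using (IsTotalOrder)
open import Algebra.Structures using (IsCommutativeRing)

-- An abstract model of the real numbers: a Dedekind-complete ordered field
-- (agda-stdlib has no real numbers).
record RealNumbers : Set₁ where
  infixl 6 _+_
  infixl 7 _*_
  infix 4 _≤ℝ_
  field
    ℝ : Set
    0ℝ 1ℝ : ℝ
    _+_ _*_ : ℝ → ℝ → ℝ
    -_ : ℝ → ℝ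
    _≤ℝ_ : ℝ → ℝ → Set
    isCommutativeRing : IsCommutativeRing _≡_ _+_ _*_ -_ 0ℝ 1ℝ
    0≢1 : 0ℝ ≢ 1ℝ
    inverse : ∀ x → x ≢ 0ℝ → Σ ℝ (λ y → x * y ≡ 1ℝ)
    isTotalOrder : IsTotalOrder _≡_ _≤ℝ_
    +-mono-≤ : ∀ {x y} z → x ≤ℝ y → x + z ≤ℝ y + z
    *-nonneg : ∀ {x y} → 0ℝ ≤ℝ x → 0ℝ ≤ℝ y → 0ℝ ≤ℝ x * y
    complete : (P : ℝ → Set) → Σ ℝ P → Σ ℝ (λ u → ∀ x → P x → x ≤ℝ u) →
               Σ ℝ (λ s → (∀ x → P x → x ≤ℝ s) ×
                          (∀ u → (∀ x → P x → x ≤ℝ u) → s ≤ℝ u))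

module _ (R : RealNumbers) where
  open RealNumbers R

  sumℝ : ∀ {n} → (Fin n → ℝ) → ℝ
  sumℝ {zero}  f = 0ℝ
  sumℝ {suc n} f = f zero + sumℝ (f ∘ suc)

  record IsPseudometric {Ω : Set} (d : Ω → Ω → ℝ) : Set where
    field
      nonneg : ∀ A B → 0ℝ ≤ℝ d A B
      refl-zero : ∀ A → d A A ≡ 0ℝ
      sym : ∀ A B → d A B ≡ d B A
      triangle : ∀ A B C → d A C ≤ℝ d A B + d B C

  replaceAt : ∀ {Ω : Set} {n} → Vector Ω n → Fin n → Ω → Vector Ω n
  replaceAt A i X = updateAt A i (const X)

  record IsPseudoNMetric {Ω : Set} (n : ℕ) (D : Vector Ω n → ℝ) : Set where
    field
      nonneg : ∀ A → 0ℝ ≤ℝ D A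
      perm-invariant : ∀ (σ : Permutation′ n) A → D (A ∘ (σ ⟨$⟩ʳ_)) ≡ D A
      generalized-triangle : ∀ A (X : Ω) →
        D A ≤ℝ sumℝ (λ i → D (replaceAt A i X))
      self-identity : ∀ (X : Ω) → D (const X) ≡ 0ℝ

  IsFermatDistance : ∀ {Ω : Set} (n : ℕ) (d : Ω → Ω → ℝ) → (Vector Ω n → ℝ) → Set
  IsFermatDistance {Ω} n d dF = ∀ A →
    Σ Ω (λ B → dF A ≡ sumℝ (λ i → d (A i) B)) ×
    (∀ B → dF A ≤ℝ sumℝ (λ i → d (A i) B))

module Submission where

-- Each axiom is a property of a minimum of the "Fermat cost" B ↦ Σ_i d(A_i, B).
--   * Non-negativity: a minimum of a non-negative function is non-negative.
--   * Self-identity: the cost of const X at B = X is Σ_i d(X, X) = 0, so the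
--     minimum is ≤ 0, hence = 0.
--   * Permutation invariance: permuting A does not change the cost function
--     (sums are permutation invariant), and minima of equal functions agree.
--   * Generalized triangle inequality (n ≥ 2): let B₁, B₂ be minimisers for
--     A with its first, resp. second, entry replaced by X.  The triangle
--     inequality d(A₁,B₁) ≤ d(A₁,B₂) + d(B₂,X) + d(X,B₁) gives
--     cost(A, B₁) ≤ cost(A¹, B₁) + cost(A², B₂), so d_F(A) ≤ d_F(A¹) + d_F(A²),
--     which is bounded by the full sum since every d_F(Aⁱ) is non-negative.

open import Defs
open import Data.Nat using (ℕ; suc; _≤_; s≤s)
open import Data.Fin using (Fin; zero; suc)
open import Data.Fin.Permutation using (Permutation′; _⟨$⟩ʳ_)
open import Data.Product using (Σ; _×_; _,_; proj₁; proj₂)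
open import Data.Vec.Functional using (Vector)
open import Function using (_∘_; const)
open import Relation.Binary.PropositionalEquality using (_≡_; refl; sym; cong; cong₂)
open import Relation.Binary.Bundles using (TotalOrder)
open import Algebra.Bundles using (CommutativeRing)
import Algebra.Properties.CommutativeMonoid.Sum as MonoidSum
import Relation.Binary.Reasoning.PartialOrder as PosetReasoning

module _ (R : RealNumbers) where
  open RealNumbers R

  private
    ring : CommutativeRing _ _
    ring = record { isCommutativeRing = isCommutativeRing }

    order : TotalOrder _ _ _
    order = record { isTotalOrder = isTotalOrder }

  open CommutativeRing ring using (+-comm; +-assoc; +-identityˡ; +-identityʳ; +-commutativeMonoid)
  open TotalOrder order using (antisym) renaming (refl to ≤-refl; trans to ≤-trans)
  open MonoidSum +-commutativeMonoid using (sum; sum-permute)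
  open PosetReasoning (TotalOrder.poset order)

  +-monoʳ-≤ : ∀ {x y} z → x ≤ℝ y → z + x ≤ℝ z + y
  +-monoʳ-≤ {x} {y} z x≤y = begin
    z + x  ≡⟨ +-comm z x ⟩
    x + z  ≤⟨ +-mono-≤ z x≤y ⟩
    y + z  ≡⟨ +-comm y z ⟩
    z + y  ∎

  +-mono₂-≤ : ∀ {a b c e} → a ≤ℝ b → c ≤ℝ e → a + c ≤ℝ b + e
  +-mono₂-≤ {b = b} {c = c} a≤b c≤e = ≤-trans (+-mono-≤ c a≤b) (+-monoʳ-≤ b c≤e)

  x≤x+nonneg : ∀ {x y} → 0ℝ ≤ℝ y → x ≤ℝ x + y
  x≤x+nonneg {x} {y} 0≤y = begin
    x       ≡⟨ sym (+-identityʳ x) ⟩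
    x + 0ℝ  ≤⟨ +-monoʳ-≤ x 0≤y ⟩
    x + y   ∎

  sum-nonneg : ∀ {n} (f : Fin n → ℝ) → (∀ i → 0ℝ ≤ℝ f i) → 0ℝ ≤ℝ sumℝ R f
  sum-nonneg {ℕ.zero} f f≥0 = ≤-refl
  sum-nonneg {suc n}  f f≥0 = begin
    0ℝ                       ≡⟨ sym (+-identityˡ 0ℝ) ⟩
    0ℝ + 0ℝ                  ≤⟨ +-mono₂-≤ (f≥0 zero) (sum-nonneg (f ∘ suc) (f≥0 ∘ suc)) ⟩
    f zero + sumℝ R (f ∘ suc) ∎

  sum-zero : ∀ n → sumℝ R {n} (const 0ℝ) ≡ 0ℝ
  sum-zero ℕ.zero  = refl
  sum-zero (suc n) = begin-equality
    0ℝ + sumℝ R {n} (const 0ℝ) ≡⟨ cong (0ℝ +_) (sum-zero n) ⟩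
    0ℝ + 0ℝ                    ≡⟨ +-identityʳ 0ℝ ⟩
    0ℝ                         ∎

  sumℝ≡sum : ∀ {n} (f : Fin n → ℝ) → sumℝ R f ≡ sum f
  sumℝ≡sum {ℕ.zero} f = refl
  sumℝ≡sum {suc n}  f = cong (f zero +_) (sumℝ≡sum (f ∘ suc))

  sumℝ-permute : ∀ {n} (f : Fin n → ℝ) (σ : Permutation′ n) →
                 sumℝ R (f ∘ (σ ⟨$⟩ʳ_)) ≡ sumℝ R f
  sumℝ-permute f σ = begin-equality
    sumℝ R (f ∘ (σ ⟨$⟩ʳ_)) ≡⟨ sumℝ≡sum (f ∘ (σ ⟨$⟩ʳ_)) ⟩
    sum (f ∘ (σ ⟨$⟩ʳ_))    ≡⟨ sym (sum-permute f σ) ⟩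
    sum f                   ≡⟨ sym (sumℝ≡sum f) ⟩
    sumℝ R f                ∎

  IsMinimumOf : {Ω : Set} → ℝ → (Ω → ℝ) → Set
  IsMinimumOf {Ω} m f = Σ Ω (λ B → m ≡ f B) × (∀ B → m ≤ℝ f B)

  module _ {Ω : Set} where

    minimum-nonneg : ∀ {m} {f : Ω → ℝ} → (∀ B → 0ℝ ≤ℝ f B) →
                     IsMinimumOf m f → 0ℝ ≤ℝ m
    minimum-nonneg {m} {f} f≥0 ((B , m≡fB) , _) = begin
      0ℝ  ≤⟨ f≥0 B ⟩
      f B ≡⟨ sym m≡fB ⟩
      m   ∎

    minimum-unique : ∀ {m m′} {f g : Ω → ℝ} → (∀ B → f B ≡ g B) →
                     IsMinimumOf m f → IsMinimumOf m′ g → m ≡ m′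
    minimum-unique {m} {m′} {f} {g} f≗g ((B , m≡fB) , m≤f) ((B′ , m′≡gB′) , m′≤g) =
      antisym m≤m′ m′≤m
      where
      m≤m′ : m ≤ℝ m′
      m≤m′ = begin m ≤⟨ m≤f B′ ⟩ f B′ ≡⟨ f≗g B′ ⟩ g B′ ≡⟨ sym m′≡gB′ ⟩ m′ ∎
      m′≤m : m′ ≤ℝ m
      m′≤m = begin m′ ≤⟨ m′≤g B ⟩ g B ≡⟨ sym (f≗g B) ⟩ f B ≡⟨ sym m≡fB ⟩ m ∎

  module Fermat {Ω : Set} (d : Ω → Ω → ℝ) (pm : IsPseudometric R d) where
    open IsPseudometric pm renaming (sym to d-sym)

    cost : ∀ {n} → Vector Ω n → Ω → ℝ
    cost A B = sumℝ R (λ i → d (A i) B)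

    cost-nonneg : ∀ {n} (A : Vector Ω n) B → 0ℝ ≤ℝ cost A B
    cost-nonneg A B = sum-nonneg _ (λ i → nonneg (A i) B)

    cost-const-self : ∀ n X → cost {n} (const X) X ≡ 0ℝ
    cost-const-self n X = begin-equality
      sumℝ R {n} (const (d X X)) ≡⟨ cong (λ z → sumℝ R {n} (const z)) (refl-zero X) ⟩
      sumℝ R {n} (const 0ℝ)      ≡⟨ sum-zero n ⟩
      0ℝ                         ∎

    cost-permute : ∀ {n} (σ : Permutation′ n) A B → cost (A ∘ (σ ⟨$⟩ʳ_)) B ≡ cost A B
    cost-permute σ A B = sumℝ-permute (λ i → d (A i) B) σ

    detour : ∀ a X B₁ B₂ → d a B₁ ≤ℝ d X B₁ + (d a B₂ + d X B₂)
    detour a X B₁ B₂ = begin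
      d a B₁                       ≤⟨ triangle a B₂ B₁ ⟩
      d a B₂ + d B₂ B₁             ≤⟨ +-monoʳ-≤ (d a B₂) (triangle B₂ X B₁) ⟩
      d a B₂ + (d B₂ X + d X B₁)   ≡⟨ cong (λ z → d a B₂ + (z + d X B₁)) (d-sym B₂ X) ⟩
      d a B₂ + (d X B₂ + d X B₁)   ≡⟨ rotate (d a B₂) (d X B₂) (d X B₁) ⟩
      d X B₁ + (d a B₂ + d X B₂)   ∎
      where
      rotate : ∀ p q r → p + (q + r) ≡ r + (p + q)
      rotate p q r = begin-equality
        p + (q + r) ≡⟨ sym (+-assoc p q r) ⟩
        (p + q) + r ≡⟨ +-comm (p + q) r ⟩
        r + (p + q) ∎

    cost-split : ∀ {m} (A : Vector Ω (suc (suc m))) X B₁ B₂ →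
      cost A B₁ ≤ℝ cost (replaceAt R A zero X) B₁ + cost (replaceAt R A (suc zero) X) B₂
    cost-split {m} A X B₁ B₂ = begin
      d a B₁ + T                              ≤⟨ +-mono-≤ T (detour a X B₁ B₂) ⟩
      (d X B₁ + (d a B₂ + d X B₂)) + T        ≡⟨ swap (d X B₁) (d a B₂ + d X B₂) T ⟩
      (d X B₁ + T) + (d a B₂ + d X B₂)        ≤⟨ +-monoʳ-≤ (d X B₁ + T) (+-monoʳ-≤ (d a B₂) (x≤x+nonneg U≥0)) ⟩
      (d X B₁ + T) + (d a B₂ + (d X B₂ + U))  ∎
      where
      a : Ω
      a = A zero
      T : ℝ
      T = sumℝ R (λ j → d (A (suc j)) B₁)
      U : ℝ
      U = cost {m} (λ j → A (suc (suc j))) B₂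
      U≥0 : 0ℝ ≤ℝ U
      U≥0 = cost-nonneg {m} (λ j → A (suc (suc j))) B₂
      swap : ∀ p q r → (p + q) + r ≡ (p + r) + q
      swap p q r = begin-equality
        (p + q) + r ≡⟨ +-assoc p q r ⟩
        p + (q + r) ≡⟨ cong (p +_) (+-comm q r) ⟩
        p + (r + q) ≡⟨ sym (+-assoc p r q) ⟩
        (p + r) + q ∎

    module _ {n} {dF : Vector Ω n → ℝ} (isFermat : IsFermatDistance R n d dF) where

      fermat-nonneg : ∀ A → 0ℝ ≤ℝ dF A
      fermat-nonneg A = minimum-nonneg (cost-nonneg A) (isFermat A)

      fermat-self-identity : ∀ X → dF (const X) ≡ 0ℝ
      fermat-self-identity X = antisym dF≤0 (fermat-nonneg (const X))
        where
        dF≤0 : dF (const X) ≤ℝ 0ℝ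
        dF≤0 = begin
          dF (const X)         ≤⟨ proj₂ (isFermat (const X)) X ⟩
          cost {n} (const X) X ≡⟨ cost-const-self n X ⟩
          0ℝ                   ∎

      fermat-permute : ∀ (σ : Permutation′ n) A → dF (A ∘ (σ ⟨$⟩ʳ_)) ≡ dF A
      fermat-permute σ A = minimum-unique (cost-permute σ A) (isFermat (A ∘ (σ ⟨$⟩ʳ_))) (isFermat A)

    -- The generalized triangle inequality, for arity at least two: only the
    -- first two replacements are needed, the others contribute non-negatively.
    fermat-triangle : ∀ {m} {dF : Vector Ω (suc (suc m)) → ℝ} →
      IsFermatDistance R (suc (suc m)) d dF →
      ∀ A X → dF A ≤ℝ sumℝ R (λ i → dF (replaceAt R A i X))
    fermat-triangle {m} {dF} isFermat A X = begin
      dF A                                ≤⟨ proj₂ (isFermat A) B₁ ⟩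
      cost A B₁                           ≤⟨ cost-split A X B₁ B₂ ⟩
      cost A¹ B₁ + cost A² B₂             ≡⟨ cong₂ _+_ (sym dF-A¹≡cost) (sym dF-A²≡cost) ⟩
      dF A¹ + dF A²                       ≤⟨ +-monoʳ-≤ (dF A¹) (x≤x+nonneg rest≥0) ⟩
      dF A¹ + (dF A² + rest)              ∎
      where
      A¹ A² : Vector Ω (suc (suc m))
      A¹ = replaceAt R A zero X
      A² = replaceAt R A (suc zero) X
      B₁ B₂ : Ω
      B₁ = proj₁ (proj₁ (isFermat A¹))
      B₂ = proj₁ (proj₁ (isFermat A²))
      dF-A¹≡cost : dF A¹ ≡ cost A¹ B₁
      dF-A¹≡cost = proj₂ (proj₁ (isFermat A¹))
      dF-A²≡cost : dF A² ≡ cost A² B₂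
      dF-A²≡cost = proj₂ (proj₁ (isFermat A²))
      rest : ℝ
      rest = sumℝ R (λ j → dF (replaceAt R A (suc (suc j)) X))
      rest≥0 : 0ℝ ≤ℝ rest
      rest≥0 = sum-nonneg _ (λ j → fermat-nonneg isFermat (replaceAt R A (suc (suc j)) X))

theorem1 : (R : RealNumbers) (n : ℕ) → 2 ≤ n →
    (Ω : Set) → Ω →
    (d : Ω → Ω → RealNumbers.ℝ R) → IsPseudometric R d →
    (dF : Vector Ω n → RealNumbers.ℝ R) → IsFermatDistance R n d dF →
    IsPseudoNMetric R n dF
theorem1 R (suc (suc m)) (s≤s (s≤s _)) Ω _ d isPseudometric dF isFermat = record
  { nonneg               = fermat-nonneg isFermat
  ; perm-invariant       = fermat-permute isFermat
  ; generalized-triangle = fermat-triangle isFermat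
  ; self-identity        = fermat-self-identity isFermat
  }
  where open Fermat R d isPseudometric
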